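{- Let $A$ be an alternating sign matrix containing a bad $-1$ in position $(i,j)$. Let $A'$ be the ASM obtained from $A$ by removing, via one step of the SW key process, any removable $-1$ other than the one in position $(i,j)$. Then the $-1$ entry in position $(i,j)$ of $A'$ is still bad.
   Context: An alternating sign matrix (ASM) of size $n$ is an $n\times n$ matrix with entries in $\{0,1,-1\}$ such that every row and every column sums to $1$ and the nonzero entries of each row and of each column alternate in sign. Position $(i,j)$ is the $i$-th row from the top and $j$-th column from the left. A $-1$ in position $(i,j)$ of an ASM $A$ is bad if, letting $(i,j_0)$ be the position of the first $1$ to its west in row $i$, there exists a column index $j'$ with $j_0<j'<j$ such that the first nonzero entry of $A$ strictly below row $i$ in column $j'$ exists and equals $1$. One step of the SW key process: a $-1$ entry is removable if no other $-1$ entry lies weakly southwest of it (weakly below and weakly to the left). For a removable $-1$ at $(i,j)$, let $(i,j_0)$ be the nearest $1$ to its west in its row and $(i_0,j)$ the nearest $1$ below it in its column; its neighboring $1$s are the $1$ entries weakly southwest of it such that no other $1$ entry lies both weakly northeast of them and weakly southwest of the $-1$. Consider the $1$s at $(i,j_0)$, $(i_0,j)$ and the neighboring $1$s lying in the rectangle of rows $i..i_0$ and columns $j_0..j$. Replace the south-most of these $1$s by $0$; then moving east to west, for each subsequent one of these $1$s, in column $c$ say, place a new $1$ in the row of the previously replaced $1$ and column $c$, and replace the old $1$ in column $c$ by $0$; finally replace the $-1$ by $0$. The result is again an ASM. -}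

module Defs where

open import Data.Nat using (ℕ)
open import Data.Fin using (Fin; zero; suc; _<_; _≤_)
open import Data.Integer using (ℤ; 0ℤ; 1ℤ; -1ℤ; _+_)
open import Data.Product using (Σ; _×_; _,_)
open import Data.Sum using (_⊎_)
open import Data.Empty using (⊥)
open import Relation.Nullary using (¬_)
open import Relation.Binary.PropositionalEquality using (_≡_; _≢_)

-- An n×n integer matrix; entry (r , c) is row r (from the top), column c (from the left).
Matrix : ℕ → Set
Matrix n = Fin n → Fin n → ℤ

sumℤ : ∀ {n} → (Fin n → ℤ) → ℤ
sumℤ {ℕ.zero}  f = 0ℤ
sumℤ {ℕ.suc n} f = f zero + sumℤ (λ k → f (suc k))

Alternating : ∀ {n} → (Fin n → ℤ) → Set
Alternating {n} v =
  (a b : Fin n) → a < b → v a ≢ 0ℤ → v b ≢ 0ℤ →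
  ((k : Fin n) → a < k → k < b → v k ≡ 0ℤ) → v a ≢ v b

record IsASM {n : ℕ} (A : Matrix n) : Set where
  field
    entries  : (r c : Fin n) → (A r c ≡ 0ℤ) ⊎ ((A r c ≡ 1ℤ) ⊎ (A r c ≡ -1ℤ))
    rowSum   : (r : Fin n) → sumℤ (λ c → A r c) ≡ 1ℤ
    colSum   : (c : Fin n) → sumℤ (λ r → A r c) ≡ 1ℤ
    rowAlt   : (r : Fin n) → Alternating (λ c → A r c)
    colAlt   : (c : Fin n) → Alternating (λ r → A r c)

NearestWestOne : ∀ {n} → Matrix n → Fin n → Fin n → Fin n → Set
NearestWestOne {n} A i j j0 =
  j0 < j × A i j0 ≡ 1ℤ × ((k : Fin n) → j0 < k → k < j → A i k ≢ 1ℤ)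

NearestSouthOne : ∀ {n} → Matrix n → Fin n → Fin n → Fin n → Set
NearestSouthOne {n} A i j i0 =
  i < i0 × A i0 j ≡ 1ℤ × ((r : Fin n) → i < r → r < i0 → A r j ≢ 1ℤ)

FirstNonzeroBelowIsOne : ∀ {n} → Matrix n → Fin n → Fin n → Set
FirstNonzeroBelowIsOne {n} A i c =
  Σ (Fin n) λ r → i < r × A r c ≡ 1ℤ × ((r' : Fin n) → i < r' → r' < r → A r' c ≡ 0ℤ)

Bad : ∀ {n} → Matrix n → Fin n → Fin n → Set
Bad {n} A i j =
  A i j ≡ -1ℤ ×
  Σ (Fin n) λ j0 → NearestWestOne A i j j0 ×
    Σ (Fin n) λ j' → j0 < j' × j' < j × FirstNonzeroBelowIsOne A i j'

Removable : ∀ {n} → Matrix n → Fin n → Fin n → Set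
Removable {n} A i j =
  A i j ≡ -1ℤ ×
  ((r c : Fin n) → i ≤ r → c ≤ j → ¬ (r ≡ i × c ≡ j) → A r c ≢ -1ℤ)

NeighboringOne : ∀ {n} → Matrix n → Fin n → Fin n → Fin n → Fin n → Set
NeighboringOne {n} A i j r c =
  A r c ≡ 1ℤ × i ≤ r × c ≤ j ×
  ((r' c' : Fin n) → A r' c' ≡ 1ℤ → r' ≤ r → c ≤ c' → i ≤ r' → c' ≤ j →
     (r' ≡ r × c' ≡ c))

InMoved : ∀ {n} → Matrix n → (i j j0 i0 : Fin n) → Fin n → Fin n → Set
InMoved A i j j0 i0 r c =
  (r ≡ i × c ≡ j0) ⊎
  ((r ≡ i0 × c ≡ j) ⊎
   (NeighboringOne A i j r c × i ≤ r × r ≤ i0 × j0 ≤ c × c ≤ j))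

-- Position (r , c) receives a new 1: some moved 1 lies in column c, and the moved 1
-- which is next to the east of it (the previously replaced one, going east to west)
-- lies in row r.
NewOne : ∀ {n} → Matrix n → (i j j0 i0 : Fin n) → Fin n → Fin n → Set
NewOne {n} A i j j0 i0 r c =
  Σ (Fin n) λ r1 → Σ (Fin n) λ c2 →
    InMoved A i j j0 i0 r1 c × InMoved A i j j0 i0 r c2 × c < c2 ×
    ((r3 c3 : Fin n) → InMoved A i j j0 i0 r3 c3 → c < c3 → c3 < c2 → ⊥)

SWStep : ∀ {n} → Matrix n → Fin n → Fin n → Matrix n → Set
SWStep {n} A i j A' =
  Σ (Fin n) λ j0 → Σ (Fin n) λ i0 →
    NearestWestOne A i j j0 × NearestSouthOne A i j i0 ×
    ((r c : Fin n) → (r ≡ i × c ≡ j) ⊎ InMoved A i j j0 i0 r c → A' r c ≡ 0ℤ) ×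
    ((r c : Fin n) → NewOne A i j j0 i0 r c → A' r c ≡ 1ℤ) ×
    ((r c : Fin n) → ¬ (r ≡ i × c ≡ j) → ¬ InMoved A i j j0 i0 r c →
       ¬ NewOne A i j j0 i0 r c → A' r c ≡ A r c)

-- Removing the -1 at (k , l) only changes entries in the rectangle of rows k..b and columns
-- a..l, and there the moved 1s form a chain running south-east; each of them is replaced by a 1
-- in its own column, in the row of the next moved 1 to the east.  If the bad -1 at (i , j) lies
-- north of row k, south of row b, or its west 1 lies east of column l, the witnesses of badness
-- survive (north of k, a moved 1 met first below row i is replaced by a 1 further south).
-- Otherwise l < j; take the easternmost moved 1 weakly north of row i.  Its column receives a new
-- 1 strictly south of row i and becomes the new witness column: if that moved 1 is not in row i,
-- the west 1 of (i , j) is untouched and lies west of it; if it is, it was the west 1 itself, and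
-- the new 1 which the preceding moved 1 creates in row i takes over.  When i = b the west 1 is
-- (b , l) itself and is replaced in the same way, while the old witness column lies east of l.

module Submission where

open import Defs
open import Data.Empty using (⊥; ⊥-elim)
open import Data.Fin using (Fin; _<_; _≤_)
open import Data.Fin.Induction using (<-wellFounded; >-wellFounded)
open import Data.Fin.Properties
  using (_≟_; _<?_; _≤?_; <-cmp; <-trans; <⇒≢; ≤∧≢⇒<; ≤-antisym; ≤-reflexive; ≤-refl; ≤-trans;
         any?; all?)
open import Data.Integer using (ℤ; 0ℤ; 1ℤ; -1ℤ)
import Data.Integer.Properties as ℤ
open import Data.Nat using (ℕ)
import Data.Nat.Properties as ℕ
open import Data.Product using (_×_; ∃-syntax; _,_; proj₁; proj₂)
open import Data.Sum using (_⊎_; inj₁; inj₂)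
open import Function using (_∘_; flip)
open import Induction.WellFounded using (WellFounded; Acc; acc)
open import Relation.Binary using (Rel; Decidable; tri<; tri≈; tri>)
open import Relation.Binary.PropositionalEquality using (_≡_; _≢_; refl; sym; trans; cong; subst)
open import Relation.Nullary using (¬_; Dec; yes; no; ¬?; _×-dec_; _⊎-dec_; _→-dec_)
open import Relation.Nullary.Decidable using (decidable-stable)

module _ {n ℓ} {_≺_ : Rel (Fin n) ℓ} (≺-wellFounded : WellFounded _≺_) (_≺?_ : Decidable _≺_) where

  ≺-minimal : {P : Fin n → Set} → (∀ x → Dec (P x)) →
              ∀ {x} → P x → ∃[ m ] P m × (∀ y → y ≺ m → ¬ P y)
  ≺-minimal {P} P? {x} = descend (≺-wellFounded x)
    where
    descend : ∀ {x} → Acc _≺_ x → P x → ∃[ m ] P m × (∀ y → y ≺ m → ¬ P y)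
    descend {x} (acc below) px with any? (λ y → (y ≺? x) ×-dec P? y)
    ... | yes (y , y≺x , py) = descend (below y≺x) py
    ... | no none            = x , px , λ y y≺x py → none (y , y≺x , py)

least : ∀ {n} {P : Fin n → Set} → (∀ x → Dec (P x)) →
        ∀ {x} → P x → ∃[ m ] P m × (∀ y → y < m → ¬ P y)
least = ≺-minimal <-wellFounded _<?_

greatest : ∀ {n} {P : Fin n → Set} → (∀ x → Dec (P x)) →
           ∀ {x} → P x → ∃[ m ] P m × (∀ y → m < y → ¬ P y)
greatest = ≺-minimal >-wellFounded (flip _<?_)

unique-by-< : ∀ {n} {P : Fin n → Set} → (∀ {x y} → x < y → P x → P y → ⊥) →
              ∀ {x y} → P x → P y → x ≡ y
unique-by-< no-two {x} {y} px py with <-cmp x y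
... | tri< x<y _ _ = ⊥-elim (no-two x<y px py)
... | tri≈ _ x≡y _ = x≡y
... | tri> _ _ y<x = ⊥-elim (no-two y<x py px)

1≢0 : 1ℤ ≢ 0ℤ
1≢0 ()

-1≢0 : -1ℤ ≢ 0ℤ
-1≢0 ()

1≢-1 : 1ℤ ≢ -1ℤ
1≢-1 ()

alternating-gap : ∀ {n} {v : Fin n → ℤ} {x y : Fin n} {s : ℤ} → Alternating v → x < y →
                  v x ≡ s → v y ≡ s → s ≢ 0ℤ → ∃[ z ] x < z × z < y × v z ≢ 0ℤ × v z ≢ s
alternating-gap {v = v} {x} {y} {s} alt x<y vx≡s vy≡s s≢0
  with least (λ z → (x <? z) ×-dec ¬? (v z ℤ.≟ 0ℤ)) (x<y , s≢0 ∘ trans (sym vy≡s))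
... | z , (x<z , vz≢0) , first = z , x<z , z<y , vz≢0 , vz≢s
  where
  zeros : ∀ c → x < c → c < z → v c ≡ 0ℤ
  zeros c x<c c<z = decidable-stable (v c ℤ.≟ 0ℤ) (λ vc≢0 → first c c<z (x<c , vc≢0))
  vz≢s : v z ≢ s
  vz≢s vz≡s = alt x z x<z (s≢0 ∘ trans (sym vx≡s)) vz≢0 zeros (trans vx≡s (sym vz≡s))
  z<y : z < y
  z<y = ≤∧≢⇒< (ℕ.≮⇒≥ λ y<z → first y y<z (x<y , s≢0 ∘ trans (sym vy≡s)))
              (λ z≡y → vz≢s (trans (cong v z≡y) vy≡s))

module _ {n} {A : Matrix n} (asm : IsASM A) where
  open IsASM asm

  private
    nonzero-entry : ∀ {r c} → A r c ≢ 0ℤ → A r c ≡ 1ℤ ⊎ A r c ≡ -1ℤ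
    nonzero-entry {r} {c} ≢0 with entries r c
    ... | inj₁ ≡0 = ⊥-elim (≢0 ≡0)
    ... | inj₂ e  = e

    ≢0∧≢1⇒-1 : ∀ {r c} → A r c ≢ 0ℤ → A r c ≢ 1ℤ → A r c ≡ -1ℤ
    ≢0∧≢1⇒-1 ≢0 ≢1 with nonzero-entry ≢0
    ... | inj₁ ≡1  = ⊥-elim (≢1 ≡1)
    ... | inj₂ ≡-1 = ≡-1

    ≢0∧≢-1⇒1 : ∀ {r c} → A r c ≢ 0ℤ → A r c ≢ -1ℤ → A r c ≡ 1ℤ
    ≢0∧≢-1⇒1 ≢0 ≢-1 with nonzero-entry ≢0
    ... | inj₁ ≡1  = ≡1
    ... | inj₂ ≡-1 = ⊥-elim (≢-1 ≡-1)

  row-ones-gap : ∀ {r c₁ c₂} → c₁ < c₂ → A r c₁ ≡ 1ℤ → A r c₂ ≡ 1ℤ →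
                 ∃[ c ] c₁ < c × c < c₂ × A r c ≡ -1ℤ
  row-ones-gap {r} c₁<c₂ e₁ e₂ with alternating-gap (rowAlt r) c₁<c₂ e₁ e₂ 1≢0
  ... | c , c₁<c , c<c₂ , ≢0 , ≢1 = c , c₁<c , c<c₂ , ≢0∧≢1⇒-1 ≢0 ≢1

  col-ones-gap : ∀ {c r₁ r₂} → r₁ < r₂ → A r₁ c ≡ 1ℤ → A r₂ c ≡ 1ℤ →
                 ∃[ r ] r₁ < r × r < r₂ × A r c ≡ -1ℤ
  col-ones-gap {c} r₁<r₂ e₁ e₂ with alternating-gap (colAlt c) r₁<r₂ e₁ e₂ 1≢0
  ... | r , r₁<r , r<r₂ , ≢0 , ≢1 = r , r₁<r , r<r₂ , ≢0∧≢1⇒-1 ≢0 ≢1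

  row-minus-ones-gap : ∀ {r c₁ c₂} → c₁ < c₂ → A r c₁ ≡ -1ℤ → A r c₂ ≡ -1ℤ →
                       ∃[ c ] c₁ < c × c < c₂ × A r c ≡ 1ℤ
  row-minus-ones-gap {r} c₁<c₂ e₁ e₂ with alternating-gap (rowAlt r) c₁<c₂ e₁ e₂ -1≢0
  ... | c , c₁<c , c<c₂ , ≢0 , ≢-1 = c , c₁<c , c<c₂ , ≢0∧≢-1⇒1 ≢0 ≢-1

nearestWestOne-transfer : ∀ {n} {A B : Matrix n} {i j j0} → (∀ c → j0 ≤ c → c < j → B i c ≡ A i c) →
                          NearestWestOne A i j j0 → NearestWestOne B i j j0
nearestWestOne-transfer agree (j0<j , one , nearest) =
  j0<j , trans (agree _ ≤-refl j0<j) one ,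
  λ c j0<c c<j → nearest c j0<c c<j ∘ trans (sym (agree c (ℕ.<⇒≤ j0<c) c<j))

firstNonzeroBelowIsOne-transfer : ∀ {n} {A B : Matrix n} {i c} (first : FirstNonzeroBelowIsOne A i c) →
                                  (∀ r → i < r → r ≤ proj₁ first → B r c ≡ A r c) →
                                  FirstNonzeroBelowIsOne B i c
firstNonzeroBelowIsOne-transfer (r , i<r , one , zeros) agree =
  r , i<r , trans (agree r i<r ≤-refl) one ,
  λ r′ i<r′ r′<r → trans (agree r′ i<r′ (ℕ.<⇒≤ r′<r)) (zeros r′ i<r′ r′<r)

module _ {n} (A : Matrix n) (k l : Fin n) where

  neighboringOne? : ∀ r c → Dec (NeighboringOne A k l r c)
  neighboringOne? r c =
    (A r c ℤ.≟ 1ℤ) ×-dec (k ≤? r) ×-dec (c ≤? l) ×-dec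
    all? (λ r′ → all? (λ c′ →
      (A r′ c′ ℤ.≟ 1ℤ) →-dec (r′ ≤? r) →-dec (c ≤? c′) →-dec (k ≤? r′) →-dec (c′ ≤? l) →-dec
      ((r′ ≟ r) ×-dec (c′ ≟ c))))

  inMoved? : ∀ j0 i0 r c → Dec (InMoved A k l j0 i0 r c)
  inMoved? j0 i0 r c =
    ((r ≟ k) ×-dec (c ≟ j0)) ⊎-dec ((r ≟ i0) ×-dec (c ≟ l)) ⊎-dec
    (neighboringOne? r c ×-dec (k ≤? r) ×-dec (r ≤? i0) ×-dec (j0 ≤? c) ×-dec (c ≤? l))

  neighboringOne-monotone : ∀ {r c r′ c′} → NeighboringOne A k l r c →
                            A r′ c′ ≡ 1ℤ → k ≤ r′ → c′ ≤ l → c ≤ c′ → r ≤ r′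
  neighboringOne-monotone {r} {r′ = r′} {c′} (_ , _ , _ , maximal) e k≤r′ c′≤l c≤c′ with r ≤? r′
  ... | yes r≤r′ = r≤r′
  ... | no r≰r′  =
    ≤-reflexive (sym (proj₁ (maximal r′ c′ e (ℕ.<⇒≤ (ℕ.≰⇒> r≰r′)) c≤c′ k≤r′ c′≤l)))

  neighboringOne-dominating : ∀ {x y} → A x y ≡ 1ℤ → k ≤ x → y ≤ l →
                              ∃[ x′ ] ∃[ y′ ] NeighboringOne A k l x′ y′ × x′ ≤ x × y ≤ y′
  neighboringOne-dominating {x} {y} e k≤x y≤l
    with greatest (λ c → (y ≤? c) ×-dec (c ≤? l) ×-dec
                         any? (λ r → (k ≤? r) ×-dec (r ≤? x) ×-dec (A r c ℤ.≟ 1ℤ)))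
                  (≤-refl , y≤l , x , k≤x , ≤-refl , e)
  ... | c , (y≤c , c≤l , r₀ , k≤r₀ , r₀≤x , e₀) , eastmost
    with least (λ r → (k ≤? r) ×-dec (r ≤? x) ×-dec (A r c ℤ.≟ 1ℤ)) (k≤r₀ , r₀≤x , e₀)
  ...   | r , (k≤r , r≤x , eᵣ) , northmost = r , c , (eᵣ , k≤r , c≤l , maximal) , r≤x , y≤c
    where
    maximal : ∀ r′ c′ → A r′ c′ ≡ 1ℤ → r′ ≤ r → c ≤ c′ → k ≤ r′ → c′ ≤ l → r′ ≡ r × c′ ≡ c
    maximal r′ c′ e′ r′≤r c≤c′ k≤r′ c′≤l = r′≡r , c′≡c
      where
      c′≡c : c′ ≡ c
      c′≡c = ≤-antisym (ℕ.≮⇒≥ λ c<c′ → eastmost c′ c<c′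
               (≤-trans y≤c c≤c′ , c′≤l , r′ , k≤r′ , ≤-trans r′≤r r≤x , e′)) c≤c′
      r′≡r : r′ ≡ r
      r′≡r = ≤-antisym r′≤r (ℕ.≮⇒≥ λ r′<r → northmost r′ r′<r
               (k≤r′ , ≤-trans r′≤r r≤x , subst (λ z → A r′ z ≡ 1ℤ) c′≡c e′))

module Quadrant {n} {A : Matrix n} (asm : IsASM A) {k l : Fin n} (rem : Removable A k l) where

  no-other-minus-one : ∀ {r c} → k ≤ r → c ≤ l → A r c ≡ -1ℤ → r ≡ k × c ≡ l
  no-other-minus-one {r} {c} k≤r c≤l e =
    decidable-stable ((r ≟ k) ×-dec (c ≟ l)) (λ ≢kl → proj₂ rem r c k≤r c≤l ≢kl e)

  minus-one-east : ∀ {i j} → k ≤ i → A i j ≡ -1ℤ → ¬ (k ≡ i × l ≡ j) → l < j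
  minus-one-east k≤i e kl≢ij = ℕ.≰⇒> λ j≤l → kl≢ij (flip-eqs (no-other-minus-one k≤i j≤l e))
    where
    flip-eqs : ∀ {i j} → i ≡ k × j ≡ l → k ≡ i × l ≡ j
    flip-eqs (refl , refl) = refl , refl

  row-one-unique : ∀ {r c₁ c₂} → k ≤ r → c₁ ≤ l → c₂ ≤ l → A r c₁ ≡ 1ℤ → A r c₂ ≡ 1ℤ → c₁ ≡ c₂
  row-one-unique {r} k≤r c₁≤l c₂≤l e₁ e₂ = unique-by-< no-two (c₁≤l , e₁) (c₂≤l , e₂)
    where
    no-two : ∀ {c₁ c₂} → c₁ < c₂ → c₁ ≤ l × A r c₁ ≡ 1ℤ → c₂ ≤ l × A r c₂ ≡ 1ℤ → ⊥
    no-two c₁<c₂ (_ , e₁) (c₂≤l , e₂) with row-ones-gap asm c₁<c₂ e₁ e₂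
    ... | c , _ , c<c₂ , e with no-other-minus-one k≤r (ℕ.<⇒≤ (ℕ.<-≤-trans c<c₂ c₂≤l)) e
    ...   | _ , refl = ℕ.<-irrefl refl (ℕ.<-≤-trans c<c₂ c₂≤l)

  col-one-unique : ∀ {c r₁ r₂} → c ≤ l → k ≤ r₁ → k ≤ r₂ → A r₁ c ≡ 1ℤ → A r₂ c ≡ 1ℤ → r₁ ≡ r₂
  col-one-unique {c} c≤l k≤r₁ k≤r₂ e₁ e₂ = unique-by-< no-two (k≤r₁ , e₁) (k≤r₂ , e₂)
    where
    no-two : ∀ {r₁ r₂} → r₁ < r₂ → k ≤ r₁ × A r₁ c ≡ 1ℤ → k ≤ r₂ × A r₂ c ≡ 1ℤ → ⊥
    no-two r₁<r₂ (k≤r₁ , e₁) (_ , e₂) with col-ones-gap asm r₁<r₂ e₁ e₂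
    ... | r , r₁<r , _ , e with no-other-minus-one (ℕ.<⇒≤ (ℕ.≤-<-trans k≤r₁ r₁<r)) c≤l e
    ...   | refl , _ = ℕ.<-irrefl refl (ℕ.≤-<-trans k≤r₁ r₁<r)

  col-zero-below-one : ∀ {c r₁ r} → c ≤ l → k ≤ r₁ → A r₁ c ≡ 1ℤ → r₁ < r → A r c ≡ 0ℤ
  col-zero-below-one {c} {r₁} {r} c≤l k≤r₁ e₁ r₁<r = zero-entry (IsASM.entries asm r c)
    where
    k<r : k < r
    k<r = ℕ.≤-<-trans k≤r₁ r₁<r

    zero-entry : A r c ≡ 0ℤ ⊎ (A r c ≡ 1ℤ ⊎ A r c ≡ -1ℤ) → A r c ≡ 0ℤ
    zero-entry (inj₁ ≡0)         = ≡0
    zero-entry (inj₂ (inj₁ ≡1))  = ⊥-elim (<⇒≢ r₁<r (col-one-unique c≤l k≤r₁ (ℕ.<⇒≤ k<r) e₁ ≡1))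
    zero-entry (inj₂ (inj₂ ≡-1)) =
      ⊥-elim (<⇒≢ k<r (sym (proj₁ (no-other-minus-one (ℕ.<⇒≤ k<r) c≤l ≡-1))))

module Step {n} {A A′ : Matrix n} (asm : IsASM A) {k l : Fin n} (rem : Removable A k l)
            {a b : Fin n} (west : NearestWestOne A k l a) (south : NearestSouthOne A k l b)
            (zeroed  : ∀ r c → (r ≡ k × c ≡ l) ⊎ InMoved A k l a b r c → A′ r c ≡ 0ℤ)
            (created : ∀ r c → NewOne A k l a b r c → A′ r c ≡ 1ℤ)
            (kept    : ∀ r c → ¬ (r ≡ k × c ≡ l) → ¬ InMoved A k l a b r c →
                       ¬ NewOne A k l a b r c → A′ r c ≡ A r c) where

  open Quadrant asm rem

  Moved : Fin n → Fin n → Set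
  Moved = InMoved A k l a b

  New : Fin n → Fin n → Set
  New = NewOne A k l a b

  private
    Akl : A k l ≡ -1ℤ
    Akl = proj₁ rem

    a<l : a < l
    a<l = proj₁ west

    k<b : k < b
    k<b = proj₁ south

  westmost : Moved k a
  westmost = inj₁ (refl , refl)

  southmost : Moved b l
  southmost = inj₂ (inj₁ (refl , refl))

  record Bounds (r c : Fin n) : Set where
    constructor bounds
    field
      one   : A r c ≡ 1ℤ
      k≤row : k ≤ r
      row≤b : r ≤ b
      a≤col : a ≤ c
      col≤l : c ≤ l

  open Bounds

  moved-bounds : ∀ {r c} → Moved r c → Bounds r c
  moved-bounds (inj₁ (refl , refl)) =
    bounds (proj₁ (proj₂ west)) ≤-refl (ℕ.<⇒≤ k<b) ≤-refl (ℕ.<⇒≤ a<l)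
  moved-bounds (inj₂ (inj₁ (refl , refl))) =
    bounds (proj₁ (proj₂ south)) (ℕ.<⇒≤ k<b) ≤-refl (ℕ.<⇒≤ a<l) ≤-refl
  moved-bounds (inj₂ (inj₂ ((one , k≤r , _ , _) , _ , r≤b , a≤c , c≤l))) = bounds one k≤r r≤b a≤c c≤l

  one-not-removed : ∀ {r c} → A r c ≡ 1ℤ → ¬ (r ≡ k × c ≡ l)
  one-not-removed e (refl , refl) = 1≢-1 (trans (sym e) Akl)

  col-l-one-south : ∀ {r} → A r l ≡ 1ℤ → k ≤ r → b ≤ r
  col-l-one-south {r} e k≤r = ℕ.≮⇒≥ λ r<b → proj₂ (proj₂ south) r k<r r<b e
    where
    k<r : k < r
    k<r = ≤∧≢⇒< k≤r (λ k≡r → one-not-removed e (sym k≡r , refl))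

  moved-monotone : ∀ {r c r′ c′} → Moved r c → Moved r′ c′ → c ≤ c′ → r ≤ r′
  moved-monotone (inj₁ (refl , refl)) m′ _ = k≤row (moved-bounds m′)
  moved-monotone (inj₂ (inj₁ (refl , refl))) m′ l≤c′
    with ≤-antisym (col≤l (moved-bounds m′)) l≤c′
  ... | refl = col-l-one-south (one (moved-bounds m′)) (k≤row (moved-bounds m′))
  moved-monotone {r′ = r′} {c′} (inj₂ (inj₂ (nb , _))) m′ c≤c′ =
    neighboringOne-monotone A k l nb (one B) (k≤row B) (col≤l B) c≤c′
    where
    B : Bounds r′ c′
    B = moved-bounds m′

  moved-row-unique : ∀ {r c c′} → Moved r c → Moved r c′ → c ≡ c′
  moved-row-unique {r} {c} {c′} m m′ = row-one-unique (k≤row B) (col≤l B) (col≤l B′) (one B) (one B′)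
    where
    B : Bounds r c
    B = moved-bounds m
    B′ : Bounds r c′
    B′ = moved-bounds m′

  moved-col-unique : ∀ {r r′ c} → Moved r c → Moved r′ c → r ≡ r′
  moved-col-unique {r} {r′} {c} m m′ = col-one-unique (col≤l B) (k≤row B) (k≤row B′) (one B) (one B′)
    where
    B : Bounds r c
    B = moved-bounds m
    B′ : Bounds r′ c
    B′ = moved-bounds m′

  moved-strict : ∀ {r c r′ c′} → Moved r c → Moved r′ c′ → c < c′ → r < r′
  moved-strict m m′ c<c′ =
    ≤∧≢⇒< (moved-monotone m m′ (ℕ.<⇒≤ c<c′)) λ { refl → <⇒≢ c<c′ (moved-row-unique m m′) }

  moved-dominating : ∀ {x y} → A x y ≡ 1ℤ → k ≤ x → x ≤ b → a ≤ y → y ≤ l →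
                     ∃[ x′ ] ∃[ y′ ] Moved x′ y′ × x′ ≤ x × y ≤ y′
  moved-dominating e k≤x x≤b a≤y y≤l with neighboringOne-dominating A k l e k≤x y≤l
  ... | x′ , y′ , nb@(_ , k≤x′ , y′≤l , _) , x′≤x , y≤y′ =
    x′ , y′ , inj₂ (inj₂ (nb , k≤x′ , ≤-trans x′≤x x≤b , ≤-trans a≤y y≤y′ , y′≤l)) , x′≤x , y≤y′

  new-below-moved : ∀ {x c} → New x c → ∃[ r ] Moved r c × r < x
  new-below-moved (r , _ , m , m₂ , c<c₂ , _) = r , m , moved-strict m m₂ c<c₂

  moved-above-new : ∀ {x r c} → Moved x c → New r c → x < r
  moved-above-new m new with new-below-moved new
  ... | _ , m′ , x′<r with moved-col-unique m m′
  ...   | refl = x′<r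

  new-col-unique : ∀ {x x′ c} → New x c → New x′ c → x ≡ x′
  new-col-unique (_ , c₂ , _ , m₂ , c<c₂ , gap) (_ , c₂′ , _ , m₂′ , c<c₂′ , gap′) with <-cmp c₂ c₂′
  ... | tri< c₂<c₂′ _ _ = ⊥-elim (gap′ _ c₂ m₂ c<c₂ c₂<c₂′)
  ... | tri≈ _ refl _   = moved-col-unique m₂ m₂′
  ... | tri> _ _ c₂′<c₂ = ⊥-elim (gap _ c₂′ m₂′ c<c₂′ c₂′<c₂)

  new-under-moved : ∀ {x c} → Moved x c → c < l → ∃[ r ] New r c
  new-under-moved {x} {c} m c<l
    with least (λ c₂ → (c <? c₂) ×-dec any? (λ r → inMoved? A k l a b r c₂)) (c<l , b , southmost)
  ... | c₂ , (c<c₂ , r , m₂) , first =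
    r , x , c₂ , m , m₂ , c<c₂ , λ r₃ c₃ m₃ c<c₃ c₃<c₂ → first c₃ c₃<c₂ (c<c₃ , r₃ , m₃)

  kept-row : ∀ {r c} → ¬ (r ≡ k × c ≡ l) → (∀ c′ → ¬ Moved r c′) → A′ r c ≡ A r c
  kept-row ≢kl unmoved = kept _ _ ≢kl (unmoved _) λ (_ , c₂ , _ , m₂ , _) → unmoved c₂ m₂

  kept-col : ∀ {r c} → ¬ (r ≡ k × c ≡ l) → (∀ r′ → ¬ Moved r′ c) → A′ r c ≡ A r c
  kept-col ≢kl unmoved = kept _ _ ≢kl (unmoved _) λ (r₁ , _ , m₁ , _) → unmoved r₁ m₁

  kept-north : ∀ {r c} → r < k → A′ r c ≡ A r c
  kept-north r<k =
    kept-row (λ (r≡k , _) → <⇒≢ r<k r≡k) λ _ m → ℕ.<⇒≱ r<k (k≤row (moved-bounds m))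

  kept-south : ∀ {r c} → b < r → A′ r c ≡ A r c
  kept-south b<r =
    kept-row (λ (r≡k , _) → <⇒≢ (<-trans k<b b<r) (sym r≡k)) λ _ m → ℕ.<⇒≱ b<r (row≤b (moved-bounds m))

  kept-east : ∀ {r c} → l < c → A′ r c ≡ A r c
  kept-east l<c =
    kept-col (λ (_ , c≡l) → <⇒≢ l<c (sym c≡l)) λ _ m → ℕ.<⇒≱ l<c (col≤l (moved-bounds m))

  kept-one : ∀ {r c} → A r c ≡ 1ℤ → ¬ Moved r c → ¬ New r c → A′ r c ≡ 1ℤ
  kept-one e unmoved old = trans (kept _ _ (one-not-removed e) unmoved old) e

  A′≢1 : ∀ {r c} → A r c ≢ 1ℤ → ¬ New r c → A′ r c ≢ 1ℤ
  A′≢1 {r} {c} A≢1 old A′≡1 with ((r ≟ k) ×-dec (c ≟ l)) ⊎-dec inMoved? A k l a b r c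
  ... | yes cleared = 1≢0 (trans (sym A′≡1) (zeroed r c cleared))
  ... | no ¬cleared = A≢1 (trans (sym (kept r c (¬cleared ∘ inj₁) (¬cleared ∘ inj₂) old)) A′≡1)

  A′≡0 : ∀ {r c} → A r c ≡ 0ℤ → ¬ New r c → A′ r c ≡ 0ℤ
  A′≡0 {r} {c} A≡0 old =
    trans (kept r c ≢kl (λ m → 1≢0 (trans (sym (one (moved-bounds m))) A≡0)) old) A≡0
    where
    ≢kl : ¬ (r ≡ k × c ≡ l)
    ≢kl (refl , refl) = -1≢0 (trans (sym Akl) A≡0)

  cleared-above-new : ∀ {x r₂ c r} → Moved x c → New r₂ c → x ≤ r → r < r₂ → A′ r c ≡ 0ℤ
  cleared-above-new {x} {c = c} {r} m new x≤r r<r₂ with x ≟ r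
  ... | yes refl = zeroed x c (inj₂ m)
  ... | no x≢r   = A′≡0 (col-zero-below-one (col≤l B) (k≤row B) (one B) (≤∧≢⇒< x≤r x≢r))
                         λ new′ → <⇒≢ r<r₂ (new-col-unique new′ new)
    where
    B : Bounds x c
    B = moved-bounds m

  nearestWestOne-kept : ∀ {i j w} → l < j → NearestWestOne A i j w → ¬ Moved i w →
                        NearestWestOne A′ i j w
  nearestWestOne-kept {i} {j} {w} l<j (w<j , Aiw , nearest) unmoved =
    w<j , kept-one Aiw unmoved (old w ≤-refl) ,
    λ c w<c c<j → A′≢1 (nearest c w<c c<j) (old c (ℕ.<⇒≤ w<c))
    where
    old : ∀ c → w ≤ c → ¬ New i c
    old c w≤c (_ , c₂ , _ , m₂ , c<c₂ , _) =
      nearest c₂ (ℕ.≤-<-trans w≤c c<c₂) (ℕ.≤-<-trans (col≤l B) l<j) (one B)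
      where
      B : Bounds i c₂
      B = moved-bounds m₂

  nearestWestOne-previous : ∀ {x c j} → Moved x c → a < c → c < j →
                            (∀ c′ → c < c′ → c′ < j → A x c′ ≢ 1ℤ) →
                            ∃[ c₀ ] c₀ < c × NearestWestOne A′ x j c₀
  nearestWestOne-previous {x} {c} {j} m a<c c<j east-free
    with greatest (λ c′ → (c′ <? c) ×-dec any? (λ r → inMoved? A k l a b r c′)) (a<c , k , westmost)
  ... | c₀ , (c₀<c , r₀ , m₀) , last = c₀ , c₀<c , <-trans c₀<c c<j , created x c₀ new , nearest
    where
    B : Bounds x c
    B = moved-bounds m

    new : New x c₀
    new = r₀ , c , m₀ , m , c₀<c , λ r₃ c₃ m₃ c₀<c₃ c₃<c → last c₃ c₀<c₃ (c₃<c , r₃ , m₃)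

    nearest : ∀ c′ → c₀ < c′ → c′ < j → A′ x c′ ≢ 1ℤ
    nearest c′ c₀<c′ c′<j with <-cmp c′ c
    ... | tri< c′<c _ _ =
      A′≢1 (λ e → <⇒≢ c′<c (row-one-unique (k≤row B) (ℕ.<⇒≤ (ℕ.<-≤-trans c′<c (col≤l B)))
                                            (col≤l B) e (one B)))
           λ (r₁ , _ , m₁ , _) → last c′ c₀<c′ (c′<c , r₁ , m₁)
    ... | tri≈ _ refl _ = λ e → 1≢0 (trans (sym e) (zeroed x c (inj₂ m)))
    ... | tri> _ _ c<c′ =
      A′≢1 (east-free c′ c<c′ c′<j)
           λ (_ , c₂ , _ , m₂ , c′<c₂ , _) → <⇒≢ (<-trans c<c′ c′<c₂) (moved-row-unique m m₂)

  firstNonzeroBelowIsOne-quadrant : ∀ {i r c} → i < k → k ≤ r → c ≤ l → A r c ≡ 1ℤ →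
                                    (∀ r′ → i < r′ → r′ < r → A r′ c ≡ 0ℤ) →
                                    FirstNonzeroBelowIsOne A′ i c
  firstNonzeroBelowIsOne-quadrant {i} {r} {c} i<k k≤r c≤l Arc zeros = from (inMoved? A k l a b r c)
    where
    i<r : i < r
    i<r = ℕ.<-≤-trans i<k k≤r

    old : ∀ {x} → x ≤ r → ¬ New x c
    old x≤r new with new-below-moved new
    ... | r₁ , m₁ , r₁<x =
      1≢0 (trans (sym (one B)) (zeros r₁ (ℕ.<-≤-trans i<k (k≤row B)) (ℕ.<-≤-trans r₁<x x≤r)))
      where
      B : Bounds r₁ c
      B = moved-bounds m₁

    cleared-north : ∀ r′ → i < r′ → r′ < r → A′ r′ c ≡ 0ℤ
    cleared-north r′ i<r′ r′<r = A′≡0 (zeros r′ i<r′ r′<r) (old (ℕ.<⇒≤ r′<r))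

    c≢l : c ≢ l
    c≢l refl with k ≟ r
    ... | yes refl = 1≢-1 (trans (sym Arc) Akl)
    ... | no k≢r   = -1≢0 (trans (sym Akl) (zeros k i<k (≤∧≢⇒< k≤r k≢r)))

    cleared-around : ∀ {r₂} → Moved r c → New r₂ c → ∀ r′ → i < r′ → r′ < r₂ → A′ r′ c ≡ 0ℤ
    cleared-around m new r′ i<r′ r′<r₂ with r′ <? r
    ... | yes r′<r = cleared-north r′ i<r′ r′<r
    ... | no r′≮r  = cleared-above-new m new (ℕ.≮⇒≥ r′≮r) r′<r₂

    from : Dec (Moved r c) → FirstNonzeroBelowIsOne A′ i c
    from (no unmoved) = r , i<r , kept-one Arc unmoved (old ≤-refl) , cleared-north
    from (yes m) =
      let r₂ , new = new-under-moved m (≤∧≢⇒< c≤l c≢l)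
      in  r₂ , <-trans i<r (moved-above-new m new) , created r₂ c new , cleared-around m new

  firstNonzeroBelowIsOne-north : ∀ {i c} → i < k → FirstNonzeroBelowIsOne A i c →
                                 FirstNonzeroBelowIsOne A′ i c
  firstNonzeroBelowIsOne-north {c = c} i<k first@(r , _ , Arc , zeros) with l <? c | r <? k
  ... | yes l<c | _       = firstNonzeroBelowIsOne-transfer {A = A} {A′} first λ _ _ _ → kept-east l<c
  ... | no _    | yes r<k =
    firstNonzeroBelowIsOne-transfer {A = A} {A′} first λ _ _ r′≤r → kept-north (ℕ.≤-<-trans r′≤r r<k)
  ... | no l≮c  | no r≮k  =
    firstNonzeroBelowIsOne-quadrant i<k (ℕ.≮⇒≥ r≮k) (ℕ.≮⇒≥ l≮c) Arc zeros

  firstNonzeroBelowIsOne-eastmost : ∀ {i rt ct} → i < b → rt ≤ i → Moved rt ct →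
                                    (∀ c → ct < c → ¬ (∃[ r ] r ≤ i × Moved r c)) →
                                    FirstNonzeroBelowIsOne A′ i ct
  firstNonzeroBelowIsOne-eastmost {i} {rt} {ct} i<b rt≤i mt eastmost =
    let r₂ , new@(_ , c₂ , _ , m₂ , ct<c₂ , _) = new-under-moved mt ct<l
        i<r₂ : i < r₂
        i<r₂ = ℕ.≰⇒> λ r₂≤i → eastmost c₂ ct<c₂ (r₂ , r₂≤i , m₂)
    in  r₂ , i<r₂ , created r₂ ct new ,
        λ r i<r r<r₂ → cleared-above-new mt new (≤-trans rt≤i (ℕ.<⇒≤ i<r)) r<r₂
    where
    ct<l : ct < l
    ct<l = ≤∧≢⇒< (col≤l (moved-bounds mt))
             λ { refl → ℕ.<⇒≱ i<b (subst (_≤ i) (moved-col-unique mt southmost) rt≤i) }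

  module BadEntry {i j w j′ : Fin n} (Aij : A i j ≡ -1ℤ) (west-i : NearestWestOne A i j w)
                  (w<j′ : w < j′) (j′<j : j′ < j) (below : FirstNonzeroBelowIsOne A i j′) where

    private
      w<j : w < j
      w<j = proj₁ west-i

      Aiw : A i w ≡ 1ℤ
      Aiw = proj₁ (proj₂ west-i)

      nearest : ∀ c → w < c → c < j → A i c ≢ 1ℤ
      nearest = proj₂ (proj₂ west-i)

    bad-north : i < k → Bad A′ i j
    bad-north i<k =
      trans (kept-north i<k) Aij , w ,
      nearestWestOne-transfer {A = A} {A′} (λ _ _ _ → kept-north i<k) west-i ,
      j′ , w<j′ , j′<j , firstNonzeroBelowIsOne-north i<k below

    bad-south : b < i → Bad A′ i j
    bad-south b<i =
      trans (kept-south b<i) Aij , w ,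
      nearestWestOne-transfer {A = A} {A′} (λ _ _ _ → kept-south b<i) west-i ,
      j′ , w<j′ , j′<j ,
      firstNonzeroBelowIsOne-transfer {A = A} {A′} below λ _ i<r _ → kept-south (<-trans b<i i<r)

    bad-east : l < w → Bad A′ i j
    bad-east l<w =
      trans (kept-east (<-trans l<w w<j)) Aij , w ,
      nearestWestOne-transfer {A = A} {A′} (λ _ w≤c _ → kept-east (ℕ.<-≤-trans l<w w≤c)) west-i ,
      j′ , w<j′ , j′<j ,
      firstNonzeroBelowIsOne-transfer {A = A} {A′} below λ _ _ _ → kept-east (<-trans l<w w<j′)

    bad-last-row : l < j → i ≡ b → w ≤ l → Bad A′ i j
    bad-last-row l<j refl w≤l =
      let c₀ , c₀<l , west′ = nearestWestOne-previous southmost a<l l<j east-free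
      in  trans (kept-east l<j) Aij , c₀ , west′ , j′ , <-trans c₀<l l<j′ , j′<j ,
          firstNonzeroBelowIsOne-transfer {A = A} {A′} below λ _ _ _ → kept-east l<j′
      where
      w≡l : w ≡ l
      w≡l = ≤-antisym w≤l (ℕ.≮⇒≥ λ w<l → nearest l w<l l<j (one (moved-bounds southmost)))

      l<j′ : l < j′
      l<j′ = subst (_< j′) w≡l w<j′

      east-free : ∀ c → l < c → c < j → A i c ≢ 1ℤ
      east-free c l<c = nearest c (subst (_< c) (sym w≡l) l<c)

    removable-not-in-row : l < j → w ≤ l → k ≢ i
    removable-not-in-row l<j w≤l refl =
      let z , l<z , z<j , Aiz = row-minus-ones-gap asm l<j Akl Aij
      in  nearest z (ℕ.≤-<-trans w≤l l<z) z<j Aiz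

    bad-moved-west : l < j → k ≢ i → Moved i w → FirstNonzeroBelowIsOne A′ i w → Bad A′ i j
    bad-moved-west l<j k≢i m below′ =
      let c₀ , c₀<w , west′ = nearestWestOne-previous m a<w w<j nearest
      in  trans (kept-east l<j) Aij , c₀ , west′ , w , c₀<w , w<j , below′
      where
      a<w : a < w
      a<w = ≤∧≢⇒< (a≤col (moved-bounds m)) λ { refl → k≢i (moved-col-unique westmost m) }

    bad-inside : l < j → k ≤ i → i < b → w ≤ l → Bad A′ i j
    bad-inside l<j k≤i i<b w≤l
      with greatest (λ c → any? (λ r → (r ≤? i) ×-dec inMoved? A k l a b r c)) (k , k≤i , westmost)
    ... | ct , (rt , rt≤i , mt) , eastmost
      with firstNonzeroBelowIsOne-eastmost i<b rt≤i mt eastmost | rt ≟ i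
    ... | below′ | yes refl
      with row-one-unique k≤i (col≤l (moved-bounds mt)) w≤l (one (moved-bounds mt)) Aiw
    ...   | refl = bad-moved-west l<j (removable-not-in-row l<j w≤l) mt below′
    bad-inside l<j k≤i i<b w≤l | ct , (rt , rt≤i , mt) , eastmost | below′ | no rt≢i =
      trans (kept-east l<j) Aij , w , nearestWestOne-kept l<j west-i unmoved ,
      ct , ≤∧≢⇒< w≤ct w≢ct , ℕ.≤-<-trans (col≤l B) l<j , below′
      where
      B : Bounds rt ct
      B = moved-bounds mt

      unmoved : ¬ Moved i w
      unmoved m with ct <? w
      ... | yes ct<w = eastmost w ct<w (i , ≤-refl , m)
      ... | no ct≮w  = ℕ.<⇒≱ (≤∧≢⇒< rt≤i rt≢i) (moved-monotone m mt (ℕ.≮⇒≥ ct≮w))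

      w≢ct : w ≢ ct
      w≢ct refl = rt≢i (col-one-unique w≤l (k≤row B) k≤i (one B) Aiw)

      w≤ct : w ≤ ct
      w≤ct = ℕ.≮⇒≥ λ ct<w →
        let x′ , y′ , m′ , x′≤i , w≤y′ =
              moved-dominating Aiw k≤i (ℕ.<⇒≤ i<b) (≤-trans (a≤col B) (ℕ.<⇒≤ ct<w)) w≤l
        in  eastmost y′ (ℕ.<-≤-trans ct<w w≤y′) (x′ , x′≤i , m′)

    bad-preserved : ¬ (k ≡ i × l ≡ j) → Bad A′ i j
    bad-preserved kl≢ij with i <? k
    ... | yes i<k = bad-north i<k
    ... | no i≮k  = bad-not-north (ℕ.≮⇒≥ i≮k) (minus-one-east (ℕ.≮⇒≥ i≮k) Aij kl≢ij)
      where
      bad-not-north : k ≤ i → l < j → Bad A′ i j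
      bad-not-north k≤i l<j with <-cmp i b | l <? w
      ... | tri> _ _ b<i | _       = bad-south b<i
      ... | _            | yes l<w = bad-east l<w
      ... | tri≈ _ i≡b _ | no l≮w  = bad-last-row l<j i≡b (ℕ.≮⇒≥ l≮w)
      ... | tri< i<b _ _ | no l≮w  = bad-inside l<j k≤i i<b (ℕ.≮⇒≥ l≮w)

lemma3p7 : (n : ℕ) (A A' : Matrix n) (i j k l : Fin n) →
    IsASM A → Bad A i j →
    ¬ (k ≡ i × l ≡ j) → Removable A k l → SWStep A k l A' →
    Bad A' i j
lemma3p7 n A A′ i j k l asm (Aij , w , west-i , j′ , w<j′ , j′<j , below) kl≢ij rem
         (a , b , west , south , zeroed , created , kept) = bad-preserved kl≢ij
  where
  open Step asm rem west south zeroed created kept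
  open BadEntry Aij west-i w<j′ j′<j below
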